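{- Let $E=\{(s_q,t_q):q\in\mathbb{N}\}$ be a test and $T$ the tree generated by $E$. Let $G$ be a dense $G_\delta$ subset of $2^{\mathbb{N}}$. Then there are $\alpha_0\in G$ and a continuous map $f:2^{\mathbb{N}}\to G$ such that for each $\alpha\in 2^{\mathbb{N}}$: (a) $(\alpha_0,f(\alpha))\in[T]$; (b) for each $t\in\mathbb{N}^{<\mathbb{N}}$ and each $m\in\mathbb{N}$: (i) if $\alpha(p(tm))=1$, then there is $m'\in\mathbb{N}$ with $(\alpha_0\Delta f(\alpha))(p(tm')+1)=1$; (ii) if $(\alpha_0\Delta f(\alpha))(p(tm)+1)=1$, then there is $m'\in\mathbb{N}$ with $\alpha(p(tm'))=1$.
   Context: For $i,j\in\mathbb{N}$ let $\langle i,j\rangle:=(\sum_{k\le i+j}k)+j$; this is a bijection $\mathbb{N}^2\to\mathbb{N}$, and $\varphi=(\varphi_0,\varphi_1):\mathbb{N}\to\mathbb{N}^2$ denotes its inverse. A set $E\subseteq\bigcup_{q\in\mathbb{N}}2^q\times2^q$ is a test if: (a) for each $q$ there is exactly one pair $(s_q,t_q)\in E\cap(2^q\times 2^q)$; (b) for all $m,q\in\mathbb{N}$ and $u\in 2^{<\mathbb{N}}$ there is $v\in2^{<\mathbb{N}}$ with $(s_q0uv,t_q1uv)\in E$ and $\varphi_0(|t_q1uv|-1)=m$; (c) for each $n>0$ there are $q<n$ and $w\in2^{<\mathbb{N}}$ with $s_n=s_q0w$ and $t_n=t_q1w$. (Juxtaposition denotes concatenation.) The tree generated by $E$ is $T:=\{(s,t)\in2^{<\mathbb{N}}\times2^{<\mathbb{N}}: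 s=t=\emptyset$ or $\exists q\in\mathbb{N}\ \exists w\in2^{<\mathbb{N}}\ s=s_q0w$ and $t=t_q1w\}$, and $[T]:=\{(\alpha,\beta)\in2^{\mathbb{N}}\times2^{\mathbb{N}}:\forall n\ (\alpha|n,\beta|n)\in T\}$. For $\alpha,\beta\in2^{\mathbb{N}}$, $\alpha\Delta\beta\in2^{\mathbb{N}}$ is given by $(\alpha\Delta\beta)(i)=1$ iff $\alpha(i)\ne\beta(i)$. The map $p:\mathbb{N}^{<\mathbb{N}}\setminus\{\emptyset\}\to\mathbb{N}$ is defined by induction on length: $p(s)=s(0)$ if $|s|=1$, and $p(s)=\langle p(s|(|s|-1)),s(|s|-1)\rangle$ otherwise; $tm$ denotes the sequence $t$ followed by $m$. -}

module Defs where

open import Data.Nat using (ℕ; zero; suc; _+_; _∸_; _<_; _>_)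
open import Data.Bool using (Bool; true; false; _xor_)
open import Data.List using (List; []; _∷_; _++_; length; applyUpTo)
open import Data.List.NonEmpty using (List⁺; foldl₁; _∷ʳ_)
open import Data.Product using (Σ; ∃; _×_; _,_)
open import Data.Sum using (_⊎_)
open import Relation.Binary.PropositionalEquality using (_≡_)

-- Cantor space 2^ℕ ; bit 0 = false, bit 1 = true
Cantor : Set
Cantor = ℕ → Bool

triSum : ℕ → ℕ
triSum zero    = zero
triSum (suc n) = suc n + triSum n

⟨_,_⟩ : ℕ → ℕ → ℕ
⟨ i , j ⟩ = triSum (i + j) + j

-- φ₀ x ≡ m, for φ the inverse of ⟨_,_⟩ : "x = ⟨ m , j ⟩ for some j"
φ₀≡ : ℕ → ℕ → Set
φ₀≡ x m = ∃ λ j → ⟨ m , j ⟩ ≡ x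

p : List⁺ ℕ → ℕ
p = foldl₁ ⟨_,_⟩

prefix : Cantor → ℕ → List Bool
prefix α n = applyUpTo α n

_Δ_ : Cantor → Cantor → Cantor
(α Δ β) i = α i xor β i

record IsTest (s t : ℕ → List Bool) : Set where
  field
    len-s : ∀ q → length (s q) ≡ q
    len-t : ∀ q → length (t q) ≡ q
    cond-b : ∀ m q (u : List Bool) → ∃ λ v → ∃ λ q' →
      (s q ++ false ∷ u ++ v ≡ s q') × (t q ++ true ∷ u ++ v ≡ t q') ×
      φ₀≡ (length (t q ++ true ∷ u ++ v) ∸ 1) m
    cond-c : ∀ n → n > 0 → ∃ λ q → q < n × ∃ λ w →
      (s n ≡ s q ++ false ∷ w) × (t n ≡ t q ++ true ∷ w)

InTree : (s t : ℕ → List Bool) → List Bool → List Bool → Set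
InTree s t a b = ((a ≡ []) × (b ≡ [])) ⊎
  (∃ λ q → ∃ λ w → (a ≡ s q ++ false ∷ w) × (b ≡ t q ++ true ∷ w))

InBody : (s t : ℕ → List Bool) → Cantor → Cantor → Set
InBody s t α β = ∀ n → InTree s t (prefix α n) (prefix β n)

_⊑_ : List Bool → Cantor → Set
u ⊑ α = prefix α (length u) ≡ u

IsOpen : (Cantor → Set) → Set₁
IsOpen U = Σ (List Bool → Set) λ W →
  ∀ α → (U α → ∃ λ k → W (prefix α k)) × ((∃ λ k → W (prefix α k)) → U α)

IsGδ : (Cantor → Set) → Set₁
IsGδ G = Σ (ℕ → Cantor → Set) λ U → (∀ n → IsOpen (U n)) ×
  (∀ α → (G α → ∀ n → U n α) × ((∀ n → U n α) → G α))

Dense : (Cantor → Set) → Set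
Dense G = ∀ (u : List Bool) → ∃ λ α → (u ⊑ α) × G α

Continuous : (Cantor → Cantor) → Set
Continuous f = ∀ α n → ∃ λ k → ∀ β → (∀ i → i < k → α i ≡ β i) →
  ∀ i → i < n → f α i ≡ f β i

-- α₀ is the limit of nodes s_{q₀}0 ⊂ s_{q₁}0 ⊂ … of T, one per stage.  Stage n + 1 is a child
-- of the earlier stage φ₀ n with label κ n = φ₀ (φ₁ n): above the parent's node (s_q 0, t_q 1)
-- both sides carry the same word, extended by condition (b) of the test so that the new index
-- q' satisfies φ₀ (q' − 1) = κ n.  Since stage ⟨i, ⟨k, x⟩⟩ + 1 is the child of stage i with
-- label k created at time x, every α drives a walk through the stages: a 1 of α at x sets the
-- current label to φ₀ x, and once a label is set each step moves to the corresponding child.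
-- f α is α₀ flipped exactly at the indices of the visited stages, which keeps (α₀, f α) on T
-- and makes f continuous.  A flip at q' = p (t m') + 1 comes from some x with α x = 1 and
-- φ₀ x = φ₀ (p (t m')), and the values p (t m') exhaust that fibre of φ₀; this is (i) and (ii).
-- Forcing steps interleaved with the stages put α₀ and every f α into each open set of G.

module Submission where

open import Defs
open import Data.Nat using (ℕ; zero; suc; _+_; _∸_; _<_; _≤_; z≤n; s≤s; s≤s⁻¹; z<s; s<s; _≤′_; ≤′-refl; ≤′-step; _≟_; _<?_)
open import Data.Nat.Properties
open import Data.Bool using (Bool; true; false; not; _xor_; if_then_else_)
open import Data.Bool.Properties using (xor-assoc; xor-same; xor-identityʳ; T-≡)
open import Data.List using (List; []; _∷_; _++_; length; drop; foldl)
open import Data.List.Properties using (++-assoc; ++-identityʳ; length-applyUpTo; foldl-∷ʳ; applyUpTo-∷ʳ; ∷ʳ-++; ∷-injective; length-++; length-++-≤ˡ)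
open import Data.List.NonEmpty using (_∷ʳ_)
open import Data.Maybe using (Maybe; just; nothing)
open import Data.Maybe.Properties using (just-injective)
open import Data.Product using (Σ; ∃; _×_; _,_; proj₁; proj₂)
open import Data.Sum using (_⊎_; inj₁; inj₂; [_,_]′)
open import Relation.Binary using (tri<; tri≈; tri>)
open import Function using (_∘_)
open import Function.Bundles using (mk⇔; Equivalence)
open import Relation.Binary.PropositionalEquality
open import Relation.Nullary using (Dec; yes; no; does; contradiction)
open import Relation.Nullary.Decidable using (dec-true; dec-false; does-⇔; toWitness; isYes≗does)

open ≡-Reasoning

-- Pairing

nextPair : ℕ × ℕ → ℕ × ℕ
nextPair (zero  , b) = suc b , zero
nextPair (suc a , b) = a , suc b

unpair : ℕ → ℕ × ℕ
unpair zero    = zero , zero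
unpair (suc x) = nextPair (unpair x)

φ₀ : ℕ → ℕ
φ₀ x = proj₁ (unpair x)

φ₁ : ℕ → ℕ
φ₁ x = proj₂ (unpair x)

pair-sucʳ : ∀ a b → ⟨ a , suc b ⟩ ≡ suc ⟨ suc a , b ⟩
pair-sucʳ a b = begin
  triSum (a + suc b) + suc b  ≡⟨ cong (λ n → triSum n + suc b) (+-suc a b) ⟩
  triSum (suc a + b) + suc b  ≡⟨ +-suc _ b ⟩
  suc (triSum (suc a + b) + b) ∎

pair-suc-zero : ∀ c → ⟨ suc c , zero ⟩ ≡ suc ⟨ zero , c ⟩
pair-suc-zero c = begin
  triSum (suc c + 0) + 0  ≡⟨ +-identityʳ _ ⟩
  triSum (suc c + 0)      ≡⟨ cong triSum (+-identityʳ (suc c)) ⟩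
  suc c + triSum c        ≡⟨ cong suc (+-comm c (triSum c)) ⟩
  suc (triSum c + c)      ∎

pair-unpair : ∀ x → ⟨ φ₀ x , φ₁ x ⟩ ≡ x
pair-unpair zero = refl
pair-unpair (suc x) with unpair x | pair-unpair x
... | zero  , b | eq = trans (pair-suc-zero b) (cong suc eq)
... | suc a , b | eq = trans (pair-sucʳ a b) (cong suc eq)

unpair-pair : ∀ a b → unpair ⟨ a , b ⟩ ≡ (a , b)
unpair-pair a b = along-diagonal (a + b) a b refl
  where
  along-diagonal : ∀ n a b → a + b ≡ n → unpair ⟨ a , b ⟩ ≡ (a , b)
  along-diagonal n a (suc b) e = trans (cong unpair (pair-sucʳ a b))
    (cong nextPair (along-diagonal n (suc a) b (trans (sym (+-suc a b)) e)))
  along-diagonal n       zero    zero e = refl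
  along-diagonal (suc n) (suc c) zero e = trans (cong unpair (pair-suc-zero c))
    (cong nextPair (along-diagonal n zero c (suc-injective (trans (cong suc (sym (+-identityʳ c))) e))))

φ₀-pair : ∀ a b → φ₀ ⟨ a , b ⟩ ≡ a
φ₀-pair a b = cong proj₁ (unpair-pair a b)

φ₀≡⇒φ₀ : ∀ {x m} → φ₀≡ x m → φ₀ x ≡ m
φ₀≡⇒φ₀ {m = m} (j , refl) = φ₀-pair m j

n≤triSum : ∀ n → n ≤ triSum n
n≤triSum zero    = z≤n
n≤triSum (suc n) = m≤m+n (suc n) _

≤-pairˡ : ∀ a b → a ≤ ⟨ a , b ⟩
≤-pairˡ a b = ≤-trans (m≤m+n a b) (≤-trans (n≤triSum (a + b)) (m≤m+n _ b))

≤-pairʳ : ∀ a b → b ≤ ⟨ a , b ⟩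
≤-pairʳ a b = m≤n+m b _

≤-child : ∀ i k x → x ≤ ⟨ i , ⟨ k , x ⟩ ⟩
≤-child i k x = ≤-trans (≤-pairʳ k x) (≤-pairʳ i _)

φ₀≤ : ∀ n → φ₀ n ≤ n
φ₀≤ n = subst (φ₀ n ≤_) (pair-unpair n) (≤-pairˡ (φ₀ n) (φ₁ n))

κ : ℕ → ℕ
κ n = φ₀ (φ₁ n)

κ-pair : ∀ i k x → κ ⟨ i , ⟨ k , x ⟩ ⟩ ≡ k
κ-pair i k x = trans (cong (φ₀ ∘ proj₂) (unpair-pair i _)) (φ₀-pair k x)

p-∷ʳ : ∀ a as m → p ((a ∷ as) ∷ʳ m) ≡ ⟨ foldl ⟨_,_⟩ a as , m ⟩
p-∷ʳ a as m = foldl-∷ʳ ⟨_,_⟩ a m as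

p-∷ʳ-fibre : ∀ u m x → φ₀ x ≡ φ₀ (p (u ∷ʳ m)) → ∃ λ m' → p (u ∷ʳ m') ≡ x
p-∷ʳ-fibre []       m x _  = x , refl
p-∷ʳ-fibre (a ∷ as) m x eq = φ₁ x , (begin
  p ((a ∷ as) ∷ʳ φ₁ x)         ≡⟨ p-∷ʳ a as (φ₁ x) ⟩
  ⟨ foldl ⟨_,_⟩ a as , φ₁ x ⟩  ≡⟨ cong (λ z → ⟨ z , φ₁ x ⟩) φ₀x≡ ⟨
  ⟨ φ₀ x , φ₁ x ⟩              ≡⟨ pair-unpair x ⟩
  x                            ∎)
  where
  φ₀x≡ : φ₀ x ≡ foldl ⟨_,_⟩ a as
  φ₀x≡ = trans eq (trans (cong φ₀ (p-∷ʳ a as m)) (φ₀-pair _ m))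

-- Finite and infinite bit strings

-- Past the end of the list the junk value false is returned.
at : List Bool → ℕ → Bool
at []       _       = false
at (b ∷ _)  zero    = b
at (_ ∷ bs) (suc i) = at bs i

infix 4 _◁_ _≼_

_◁_ : List Bool → Cantor → Set
u ◁ α = ∀ i → i < length u → at u i ≡ α i

_≼_ : List Bool → List Bool → Set
u ≼ v = ∃ λ w → v ≡ u ++ w

≼-refl : ∀ u → u ≼ u
≼-refl u = [] , sym (++-identityʳ u)

≼-trans : ∀ {u v w} → u ≼ v → v ≼ w → u ≼ w
≼-trans {u} (e , refl) (e' , refl) = e ++ e' , ++-assoc u e e'

≼-++ : ∀ u e → u ≼ u ++ e
≼-++ u e = e , refl

≼-length : ∀ {u v} → u ≼ v → length u ≤ length v
≼-length {u} (e , refl) = length-++-≤ˡ u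

length-∷ʳ : ∀ (u : List Bool) b → length (u ++ b ∷ []) ≡ suc (length u)
length-∷ʳ u b = trans (length-++ u) (+-comm (length u) 1)

at-++ˡ : ∀ u e i → i < length u → at (u ++ e) i ≡ at u i
at-++ˡ (_ ∷ u) e zero    _         = refl
at-++ˡ (_ ∷ u) e (suc i) (s<s lt) = at-++ˡ u e i lt

at-++-∷ : ∀ u b e → at (u ++ b ∷ e) (length u) ≡ b
at-++-∷ []      b e = refl
at-++-∷ (_ ∷ u) b e = at-++-∷ u b e

at-++-∷-beyond : ∀ u b e i → length u < i → at (u ++ b ∷ e) i ≡ at e (i ∸ suc (length u))
at-++-∷-beyond []      b e (suc i) _         = refl
at-++-∷-beyond (_ ∷ u) b e (suc i) (s<s lt) = at-++-∷-beyond u b e i lt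

◁-last : ∀ {u b e α} → (u ++ b ∷ e) ◁ α → α (length u) ≡ b
◁-last {u} {b} {e} h = trans (sym (h (length u) (subst (length u <_) (sym (length-++ u)) (m<m+n (length u) z<s))))
  (at-++-∷ u b e)

◁-≼ : ∀ {u v α} → u ≼ v → v ◁ α → u ◁ α
◁-≼ {u} (e , refl) h i lt = trans (sym (at-++ˡ u e i lt)) (h i (≤-trans lt (length-++-≤ˡ u)))

◁⇒⊑ : ∀ u {α} → u ◁ α → u ⊑ α
◁⇒⊑ []      _ = refl
◁⇒⊑ (b ∷ u) h = cong₂ _∷_ (sym (h 0 z<s)) (◁⇒⊑ u (λ i lt → h (suc i) (s<s lt)))

⊑⇒◁ : ∀ u {α} → u ⊑ α → u ◁ α
⊑⇒◁ (b ∷ u) e zero    _         = sym (proj₁ (∷-injective e))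
⊑⇒◁ (b ∷ u) e (suc i) (s<s lt) = ⊑⇒◁ u (proj₂ (∷-injective e)) i lt

prefix-+ : ∀ (α : Cantor) m n → prefix α (m + n) ≡ prefix α m ++ prefix (λ j → α (m + j)) n
prefix-+ α zero    n = refl
prefix-+ α (suc m) n = cong (α 0 ∷_) (prefix-+ (α ∘ suc) m n)

prefix-cong : ∀ {α β : Cantor} n → (∀ i → i < n → α i ≡ β i) → prefix α n ≡ prefix β n
prefix-cong zero    h = refl
prefix-cong (suc n) h = cong₂ _∷_ (h 0 z<s) (prefix-cong n (λ i lt → h (suc i) (s<s lt)))

at-prefix : ∀ (α : Cantor) n i → i < n → at (prefix α n) i ≡ α i
at-prefix α (suc n) zero    _         = refl
at-prefix α (suc n) (suc i) (s<s lt) = at-prefix (α ∘ suc) n i lt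

prefix-splice : ∀ {X : List Bool} {q b N} (γ δ : Cantor) → length X ≡ q → q < N →
  X ◁ γ → γ q ≡ b → (∀ i → q < i → i < N → γ i ≡ δ i) →
  prefix γ N ≡ X ++ b ∷ prefix (λ j → δ (suc q + j)) (N ∸ suc q)
prefix-splice {X} {q} {b} {N} γ δ refl q<N X◁γ γq≡b γ≡δ = begin
  prefix γ N
    ≡⟨ cong (prefix γ) (m+[n∸m]≡n q<N) ⟨
  prefix γ (suc q + r)
    ≡⟨ prefix-+ γ (suc q) r ⟩
  prefix γ (suc q) ++ prefix (λ j → γ (suc q + j)) r
    ≡⟨ cong (_++ prefix (λ j → γ (suc q + j)) r) (applyUpTo-∷ʳ γ q) ⟨
  (prefix γ q ++ γ q ∷ []) ++ prefix (λ j → γ (suc q + j)) r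
    ≡⟨ ∷ʳ-++ (prefix γ q) (γ q) _ ⟩
  prefix γ q ++ γ q ∷ prefix (λ j → γ (suc q + j)) r
    ≡⟨ cong₂ (λ u v → u ++ v) (◁⇒⊑ X X◁γ) (cong₂ _∷_ γq≡b (prefix-cong r tail)) ⟩
  X ++ b ∷ prefix (λ j → δ (suc q + j)) r ∎
  where
  r = N ∸ suc q
  tail : ∀ j → j < r → γ (suc q + j) ≡ δ (suc q + j)
  tail j j<r = γ≡δ (suc q + j) (s≤s (m≤m+n q j)) (subst (suc q + j <_) (m+[n∸m]≡n q<N) (+-monoʳ-< (suc q) j<r))

◁-splice : ∀ {X Y R : List Bool} {b c} {γ δ : Cantor} → length X ≡ length Y → (X ++ b ∷ R) ◁ γ →
  Y ◁ δ → δ (length Y) ≡ c → (∀ i → length Y < i → i < length (Y ++ c ∷ R) → δ i ≡ γ i) →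
  (Y ++ c ∷ R) ◁ δ
◁-splice {X} {Y} {R} {b} {c} {γ} {δ} lenXY XbR◁γ Y◁δ δY≡c agree i i<YcR with <-cmp i (length Y)
... | tri< i<Y _ _ = trans (at-++ˡ Y (c ∷ R) i i<Y) (Y◁δ i i<Y)
... | tri≈ _ refl _ = trans (at-++-∷ Y c R) (sym δY≡c)
... | tri> _ _ Y<i = begin
  at (Y ++ c ∷ R) i          ≡⟨ at-++-∷-beyond Y c R i Y<i ⟩
  at R (i ∸ suc (length Y))  ≡⟨ cong (λ l → at R (i ∸ suc l)) lenXY ⟨
  at R (i ∸ suc (length X))  ≡⟨ at-++-∷-beyond X b R i (subst (_< i) (sym lenXY) Y<i) ⟨
  at (X ++ b ∷ R) i          ≡⟨ XbR◁γ i (subst (i <_) sameLength i<YcR) ⟩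
  γ i                        ≡⟨ agree i Y<i i<YcR ⟨
  δ i                        ∎
  where
  sameLength : length (Y ++ c ∷ R) ≡ length (X ++ b ∷ R)
  sameLength = trans (length-++ Y) (trans (cong (_+ suc (length R)) (sym lenXY)) (sym (length-++ X)))

drop-++ : ∀ (u e : List Bool) → drop (length u) (u ++ e) ≡ e
drop-++ []      e = refl
drop-++ (_ ∷ u) e = drop-++ u e

drop-++-≤ : ∀ n (u e : List Bool) → n ≤ length u → drop n (u ++ e) ≡ drop n u ++ e
drop-++-≤ zero    u       e _         = refl
drop-++-≤ (suc n) (_ ∷ u) e (s≤s le) = drop-++-≤ n u e le

≼⇒++drop : ∀ {u v} → u ≼ v → v ≡ u ++ drop (length u) v
≼⇒++drop {u} (e , refl) = cong (u ++_) (sym (drop-++ u e))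

flipHead : List Bool → List Bool
flipHead []       = []
flipHead (b ∷ bs) = not b ∷ bs

flipHead-◁ : ∀ {L E γ δ} → 0 < length L → (L ++ E) ◁ γ → δ 0 ≡ not (γ 0) →
  (∀ i → 0 < i → i < length (L ++ E) → δ i ≡ γ i) → (flipHead L ++ E) ◁ δ
flipHead-◁ {b ∷ L} _ h δ0 _  zero    _  = trans (cong not (h 0 z<s)) (sym δ0)
flipHead-◁ {b ∷ L} _ h _  δi (suc i) lt = trans (h (suc i) lt) (sym (δi (suc i) z<s lt))

module Chain (c : ℕ → List Bool) (c-≼ : ∀ n → c n ≼ c (suc n)) where

  chain-≼ : ∀ {i n} → i ≤′ n → c i ≼ c n
  chain-≼ ≤′-refl      = ≼-refl _
  chain-≼ (≤′-step le) = ≼-trans (chain-≼ le) (c-≼ _)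

  limit : Cantor
  limit y = at (c (suc y)) y

  limit-◁ : (∀ n → n < length (c n)) → ∀ n → c n ◁ limit
  limit-◁ long n y y<n = trans (sym (≼-at (chain-≼ (≤⇒≤′ (m≤m+n n (suc y)))) y y<n))
    (≼-at (chain-≼ (≤⇒≤′ (m≤n+m (suc y) n))) y (<⇒≤ (long (suc y))))
    where
    ≼-at : ∀ {u v} → u ≼ v → ∀ i → i < length u → at v i ≡ at u i
    ≼-at {u} (e , refl) i lt = at-++ˡ u e i lt

last-below : ∀ (f : ℕ → ℕ) {N} → f 0 < N → ∀ x →
  ∃ λ z → z ≤ x × f z < N × (∀ z' → z < z' → z' ≤ x → N ≤ f z')
last-below f f0<N zero = 0 , z≤n , f0<N , λ z' 0<z' z'≤0 → contradiction (<-≤-trans 0<z' z'≤0) n≮0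
last-below f {N} f0<N (suc x) with f (suc x) <? N
... | yes fx<N = suc x , ≤-refl , fx<N , λ z' x<z' z'≤x → contradiction (<-≤-trans x<z' z'≤x) (<-irrefl refl)
... | no  fx≮N with last-below f f0<N x
...   | z , z≤x , fz<N , above = z , m≤n⇒m≤1+n z≤x , fz<N , above′
  where
  above′ : ∀ z' → z < z' → z' ≤ suc x → N ≤ f z'
  above′ z' z<z' z'≤1+x with m≤n⇒m<n∨m≡n z'≤1+x
  ... | inj₁ z'<1+x = above z' z<z' (s≤s⁻¹ z'<1+x)
  ... | inj₂ refl   = ≮⇒≥ fx≮N

-- Meeting the open sets of a dense Gδ

module Forcing {G : Cantor → Set} (gδ : IsGδ G) (dense : Dense G) where

  U : ℕ → Cantor → Set
  U = proj₁ gδ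

  G⇒U : ∀ {γ} → G γ → ∀ d → U d γ
  G⇒U {γ} = proj₁ (proj₂ (proj₂ gδ) γ)

  U⇒G : ∀ {γ} → (∀ d → U d γ) → G γ
  U⇒G {γ} = proj₂ (proj₂ (proj₂ gδ) γ)

  private
    W : ℕ → List Bool → Set
    W d = proj₁ (proj₁ (proj₂ gδ) d)

    W⇒U : ∀ d γ k → W d (prefix γ k) → U d γ
    W⇒U d γ k w = proj₂ (proj₂ (proj₁ (proj₂ gδ) d) γ) (k , w)

    U⇒W : ∀ d γ → U d γ → ∃ λ k → W d (prefix γ k)
    U⇒W d γ = proj₁ (proj₂ (proj₁ (proj₂ gδ) d) γ)

    witness : List Bool → Cantor
    witness c = proj₁ (dense c)

    U-witness : ∀ d c → ∃ λ k → W d (prefix (witness c) k)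
    U-witness d c = U⇒W d (witness c) (G⇒U (proj₂ (proj₂ (dense c))) d)

    depth : ℕ → List Bool → ℕ
    depth d c = proj₁ (U-witness d c)

  -- Follow a point of G through c until it enters the open set U d.
  extend : ℕ → List Bool → List Bool
  extend d c = prefix (λ j → witness c (length c + j)) (depth d c)

  ++-extend : ∀ d c → c ++ extend d c ≡ prefix (witness c) (length c + depth d c)
  ++-extend d c = trans (cong (_++ extend d c) (sym (proj₁ (proj₂ (dense c)))))
    (sym (prefix-+ (witness c) (length c) (depth d c)))

  extend-sound : ∀ d c γ → (c ++ extend d c) ◁ γ → U d γ
  extend-sound d c γ h = W⇒U d γ k (subst (W d) (sym agree) (proj₂ (U-witness d c)))
    where
    β = witness c
    k = depth d c
    L = length c + k
    β◁γ : prefix β L ◁ γ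
    β◁γ = subst (_◁ γ) (++-extend d c) h
    agree : prefix γ k ≡ prefix β k
    agree = prefix-cong k λ i i<k →
      let i<L = ≤-trans i<k (m≤n+m k (length c)) in
      trans (sym (β◁γ i (subst (i <_) (sym (length-applyUpTo β L)) i<L))) (at-prefix β L i i<L)

  force : ℕ → List Bool → List Bool
  force zero    c = extend zero c
  force (suc n) c = force n c ++ extend (suc n) (c ++ force n c)

  force-sound : ∀ {d n} → d ≤′ n → ∀ c γ → (c ++ force n c) ◁ γ → U d γ
  force-sound {n = zero}  ≤′-refl c γ h = extend-sound zero c γ h
  force-sound {n = suc n} ≤′-refl c γ h = extend-sound (suc n) (c ++ force n c) γ
    (subst (_◁ γ) (sym (++-assoc c (force n c) _)) h)
  force-sound (≤′-step {n} le) c γ h = force-sound le c γ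
    (◁-≼ {c ++ force n c} (_ , sym (++-assoc c (force n c) _)) h)

-- The walk through the stages driven by α

relabel : Bool → ℕ → Maybe ℕ → Maybe ℕ
relabel true  x _ = just (φ₀ x)
relabel false _ k = k

label : Cantor → ℕ → Maybe ℕ
label α zero    = nothing
label α (suc x) = relabel (α x) x (label α x)

move : ℕ → ℕ → Maybe ℕ → ℕ
move x i nothing  = i
move x i (just k) = suc ⟨ i , ⟨ k , x ⟩ ⟩

visited : Cantor → ℕ → ℕ
visited α zero    = zero
visited α (suc x) = move x (visited α x) (label α (suc x))

label-cases : ∀ α x → label α x ≡ nothing ⊎ ∃ λ k → label α x ≡ just k
label-cases α x with label α x
... | nothing = inj₁ refl
... | just k  = inj₂ (k , refl)

label-true : ∀ α x → α x ≡ true → label α (suc x) ≡ just (φ₀ x)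
label-true α x e = cong (λ b → relabel b x (label α x)) e

label-just : ∀ α x {k} → label α x ≡ just k → ∃ λ x' → x' < x × α x' ≡ true × φ₀ x' ≡ k
label-just α (suc x) e with α x in αx
... | true  = x , ≤-refl , αx , just-injective e
... | false = let x' , x'<x , r = label-just α x e in x' , m≤n⇒m≤1+n x'<x , r

label-nothing : ∀ α x → label α x ≡ nothing → ∀ y → y < x → α y ≡ false
label-nothing α (suc x) e y y<1+x with α x in αx
... | false with m≤n⇒m<n∨m≡n (s≤s⁻¹ y<1+x)
...   | inj₁ y<x  = label-nothing α x e y y<x
...   | inj₂ refl = αx

label-after-silence : ∀ α d x {k} → label α (suc d) ≡ nothing → label α (suc x) ≡ just k → d ≤ x
label-after-silence α d x silent e with label-just α (suc x) e
... | x' , x'<1+x , αx' , _ = <⇒≤ (<-≤-trans d<x' (s≤s⁻¹ x'<1+x))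
  where
  d<x' : d < x'
  d<x' = ≮⇒≥ λ x'<1+d → contradiction (trans (sym αx') (label-nothing α (suc d) silent x' x'<1+d)) λ ()

visited-nothing : ∀ α x → label α x ≡ nothing → visited α x ≡ zero
visited-nothing α zero    _ = refl
visited-nothing α (suc x) e with α x in αx
... | false = trans (cong (move x (visited α x)) e) (visited-nothing α x e)

visited-suc-just : ∀ α x {k} → label α (suc x) ≡ just k → visited α (suc x) ≡ suc ⟨ visited α x , ⟨ k , x ⟩ ⟩
visited-suc-just α x e = cong (move x (visited α x)) e

visited-suc-nothing : ∀ α x → label α (suc x) ≡ nothing → visited α (suc x) ≡ visited α x
visited-suc-nothing α x e = cong (move x (visited α x)) e

label-local : ∀ α β x → (∀ i → i < x → α i ≡ β i) → label α x ≡ label β x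
label-local α β zero    _ = refl
label-local α β (suc x) h = cong₂ (λ b k → relabel b x k) (h x ≤-refl) (label-local α β x (λ i lt → h i (m<n⇒m<1+n lt)))

visited-local : ∀ α β x → (∀ i → i < x → α i ≡ β i) → visited α x ≡ visited β x
visited-local α β zero    _ = refl
visited-local α β (suc x) h = cong₂ (move x) (visited-local α β x (λ i lt → h i (m<n⇒m<1+n lt))) (label-local α β (suc x) h)

module Construction {s t : ℕ → List Bool} (test : IsTest s t)
                    {G : Cantor → Set} (gδ : IsGδ G) (dense : Dense G) where
  open IsTest test
  open Forcing gδ dense

  -- a approximates α₀ and q is the index of the parent stage φ₀ n.  U₀ … Uₙ are met along α₀,
  -- along the branches that have not left the root, and along those entering the new stage.
  module Step (n : ℕ) (a : List Bool) (q : ℕ) where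

    forced : List Bool
    forced = a ++ force n a

    forcedRoot : List Bool
    forcedRoot = forced ++ force n (flipHead forced)

    mirror : List Bool
    mirror = t q ++ true ∷ drop (suc q) forcedRoot

    grown : List Bool
    grown = forcedRoot ++ force n mirror

    private
      extension = cond-b (κ n) q (drop (suc q) grown)

    bridge : List Bool
    bridge = proj₁ extension

    next : ℕ
    next = proj₁ (proj₂ extension)

    s-next : s q ++ false ∷ drop (suc q) grown ++ bridge ≡ s next
    s-next = proj₁ (proj₂ (proj₂ extension))

    t-next : t q ++ true ∷ drop (suc q) grown ++ bridge ≡ t next
    t-next = proj₁ (proj₂ (proj₂ (proj₂ extension)))

    φ₀-next : φ₀ (next ∸ 1) ≡ κ n
    φ₀-next = φ₀≡⇒φ₀ (subst (λ l → φ₀≡ (l ∸ 1) (κ n)) (trans (cong length t-next) (len-t next))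
      (proj₂ (proj₂ (proj₂ (proj₂ extension)))))

  -- index i is the E-index of stage i for i ≤ n; later entries are junk.
  record Stage : Set where
    field
      node  : List Bool
      index : ℕ → ℕ

  override : (ℕ → ℕ) → ℕ → ℕ → ℕ → ℕ
  override f j v i = if does (i ≟ j) then v else f i

  stages : ℕ → Stage
  stages zero    = record { node = false ∷ [] ; index = λ _ → zero }
  stages (suc n) = record { node = grown ++ bridge ++ false ∷ [] ; index = override index (suc n) next }
    where
    open Stage (stages n)
    open Step n node (index (φ₀ n))

  node : ℕ → List Bool
  node n = Stage.node (stages n)

  pos : ℕ → ℕ
  pos n = Stage.index (stages n) n

  parentPos : ℕ → ℕ
  parentPos n = Stage.index (stages n) (φ₀ n)

  module At (n : ℕ) = Step n (node n) (parentPos n)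

  index-stable : ∀ {i n} → i ≤′ n → Stage.index (stages n) i ≡ pos i
  index-stable ≤′-refl = refl
  index-stable {i} (≤′-step {n} le)
    rewrite dec-false (i ≟ suc n) (<⇒≢ (s≤s (≤′⇒≤ le))) = index-stable le

  parentPos≡ : ∀ n → parentPos n ≡ pos (φ₀ n)
  parentPos≡ n = index-stable (≤⇒≤′ (φ₀≤ n))

  pos-suc : ∀ n → pos (suc n) ≡ At.next n
  pos-suc n rewrite dec-true (suc n ≟ suc n) refl = refl

  forced≼grown : ∀ n → At.forced n ≼ At.grown n
  forced≼grown n = ≼-trans (≼-++ (At.forced n) _) (≼-++ (At.forcedRoot n) _)

  node≼grown : ∀ n → node n ≼ At.grown n
  node≼grown n = ≼-trans (≼-++ (node n) _) (forced≼grown n)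

  grown≼node-suc : ∀ n → At.grown n ≼ node (suc n)
  grown≼node-suc n = ≼-++ (At.grown n) _

  open Chain node (λ n → ≼-trans (node≼grown n) (grown≼node-suc n))

  grown-over-parent : ∀ n → node (φ₀ n) ≡ s (parentPos n) ++ false ∷ [] →
    At.grown n ≡ s (parentPos n) ++ false ∷ drop (suc (parentPos n)) (At.grown n)
  grown-over-parent n parent = begin
    g                                    ≡⟨ ≼⇒++drop parent≼g ⟩
    node (φ₀ n) ++ drop (length (node (φ₀ n))) g
      ≡⟨ cong₂ (λ u l → u ++ drop l g) parent (trans (cong length parent) (trans (length-∷ʳ (s q) false) (cong suc (len-s q)))) ⟩
    (s q ++ false ∷ []) ++ drop (suc q) g ≡⟨ ∷ʳ-++ (s q) false _ ⟩
    s q ++ false ∷ drop (suc q) g        ∎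
    where
    q = parentPos n
    g = At.grown n
    parent≼g : node (φ₀ n) ≼ g
    parent≼g = ≼-trans (chain-≼ (≤⇒≤′ (φ₀≤ n))) (node≼grown n)

  s-next-over-parent : ∀ n → node (φ₀ n) ≡ s (parentPos n) ++ false ∷ [] →
    s (At.next n) ≡ At.grown n ++ At.bridge n
  s-next-over-parent n parent = begin
    s (At.next n)                            ≡⟨ At.s-next n ⟨
    s q ++ false ∷ drop (suc q) g ++ bridge  ≡⟨ ++-assoc (s q) (false ∷ drop (suc q) g) bridge ⟨
    (s q ++ false ∷ drop (suc q) g) ++ bridge ≡⟨ cong (_++ bridge) (grown-over-parent n parent) ⟨
    g ++ bridge                              ∎
    where
    q = parentPos n
    g = At.grown n
    bridge = At.bridge n

  parentPos-form : ∀ n → node (φ₀ n) ≡ s (pos (φ₀ n)) ++ false ∷ [] → node (φ₀ n) ≡ s (parentPos n) ++ false ∷ []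
  parentPos-form n = subst (λ q → node (φ₀ n) ≡ s q ++ false ∷ []) (sym (parentPos≡ n))

  node-suc-shape : ∀ n → node (φ₀ n) ≡ s (pos (φ₀ n)) ++ false ∷ [] → node (suc n) ≡ s (pos (suc n)) ++ false ∷ []
  node-suc-shape n parent = begin
    At.grown n ++ At.bridge n ++ false ∷ []   ≡⟨ ++-assoc (At.grown n) _ _ ⟨
    (At.grown n ++ At.bridge n) ++ false ∷ [] ≡⟨ cong (_++ false ∷ []) (s-next-over-parent n (parentPos-form n parent)) ⟨
    s (At.next n) ++ false ∷ []               ≡⟨ cong (λ q → s q ++ false ∷ []) (pos-suc n) ⟨
    s (pos (suc n)) ++ false ∷ []             ∎

  node-shape : ∀ n → node n ≡ s (pos n) ++ false ∷ []
  node-shape n = below n ≤′-refl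
    where
    below : ∀ n {i} → i ≤′ n → node i ≡ s (pos i) ++ false ∷ []
    below zero    ≤′-refl with s 0 | len-s 0
    ... | [] | _ = refl
    below (suc n) ≤′-refl      = node-suc-shape n (below n (≤⇒≤′ (φ₀≤ n)))
    below (suc n) (≤′-step le) = below n le

  s-pos-suc : ∀ n → s (pos (suc n)) ≡ At.grown n ++ At.bridge n
  s-pos-suc n = trans (cong s (pos-suc n)) (s-next-over-parent n (parentPos-form n (node-shape (φ₀ n))))

  s-pos-suc-split : ∀ n → s (pos (suc n)) ≡ s (parentPos n) ++ false ∷ drop (suc (parentPos n)) (At.grown n) ++ At.bridge n
  s-pos-suc-split n = trans (cong s (pos-suc n)) (sym (At.s-next n))

  t-pos-suc : ∀ n → t (pos (suc n)) ≡ t (parentPos n) ++ true ∷ drop (suc (parentPos n)) (At.grown n) ++ At.bridge n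
  t-pos-suc n = trans (cong t (pos-suc n)) (sym (At.t-next n))

  φ₀-pos-suc : ∀ n → φ₀ (pos (suc n) ∸ 1) ≡ κ n
  φ₀-pos-suc n = trans (cong (λ q → φ₀ (q ∸ 1)) (pos-suc n)) (At.φ₀-next n)

  node-length : ∀ n → length (node n) ≡ suc (pos n)
  node-length n = trans (cong length (node-shape n)) (trans (length-∷ʳ (s (pos n)) false) (cong suc (len-s (pos n))))

  grown-length : ∀ n → length (At.grown n) ≤ pos (suc n)
  grown-length n = subst (length (At.grown n) ≤_) (trans (cong length (sym (s-pos-suc n))) (len-s _))
    (length-++-≤ˡ (At.grown n))

  pos-grows : ∀ {i n} → i ≤ n → pos i < pos (suc n)
  pos-grows {i} {n} i≤n = subst (_≤ pos (suc n)) (node-length i)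
    (≤-trans (≼-length (chain-≼ (≤⇒≤′ i≤n))) (≤-trans (≼-length (node≼grown n)) (grown-length n)))

  pos-mono-≤ : ∀ {i j} → i ≤ j → pos i ≤ pos j
  pos-mono-≤ {i} {j} i≤j with m≤n⇒m<n∨m≡n i≤j
  pos-mono-≤ {i} {suc j} _ | inj₁ (s≤s i≤j) = <⇒≤ (pos-grows i≤j)
  pos-mono-≤ {i} {.i}    _ | inj₂ refl      = ≤-refl

  n≤pos : ∀ n → n ≤ pos n
  n≤pos zero    = z≤n
  n≤pos (suc n) = ≤-trans (s≤s (n≤pos n)) (pos-grows {n} ≤-refl)

  α₀ : Cantor
  α₀ = limit

  node-◁-α₀ : ∀ n → node n ◁ α₀
  node-◁-α₀ = limit-◁ λ n → subst (n <_) (sym (node-length n)) (s≤s (n≤pos n))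

  s-◁-α₀ : ∀ i → s (pos i) ◁ α₀
  s-◁-α₀ i = ◁-≼ (≼-++ (s (pos i)) _) (subst (_◁ α₀) (node-shape i) (node-◁-α₀ i))

  α₀-pos : ∀ i → α₀ (pos i) ≡ false
  α₀-pos i = trans (cong α₀ (sym (len-s (pos i)))) (◁-last {s (pos i)} (subst (_◁ α₀) (node-shape i) (node-◁-α₀ i)))

  α₀∈G : G α₀
  α₀∈G = U⇒G λ d → force-sound ≤′-refl (node d) α₀
    (◁-≼ (≼-trans (forced≼grown d) (grown≼node-suc d)) (node-◁-α₀ (suc d)))

  reach : Cantor → ℕ → ℕ
  reach α x = pos (visited α x)

  reach-suc : ∀ α x → reach α x ≤ reach α (suc x)
  reach-suc α x with label-cases α (suc x)
  ... | inj₁ e       = ≤-reflexive (cong pos (sym (visited-suc-nothing α x e)))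
  ... | inj₂ (k , e) = subst (reach α x ≤_) (cong pos (sym (visited-suc-just α x e)))
                         (<⇒≤ (pos-grows (≤-pairˡ (visited α x) _)))

  reach-mono : ∀ α {x x'} → x ≤ x' → reach α x ≤ reach α x'
  reach-mono α x≤x' = along (≤⇒≤′ x≤x')
    where
    along : ∀ {x x'} → x ≤′ x' → reach α x ≤ reach α x'
    along ≤′-refl      = ≤-refl
    along (≤′-step le) = ≤-trans (along le) (reach-suc α _)

  reach-moved : ∀ α x {k} → label α (suc x) ≡ just k → suc x ≤ reach α (suc x)
  reach-moved α x {k} e = subst (λ i → suc x ≤ pos i) (sym (visited-suc-just α x e))
    (≤-trans (s≤s (≤-child (visited α x) k x)) (n≤pos _))

  reach-early : ∀ α x {y} → reach α x ≡ y → ∃ λ x' → x' ≤ y × reach α x' ≡ y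
  reach-early α zero    e = zero , z≤n , e
  reach-early α (suc x) e with label-cases α (suc x)
  ... | inj₁ l       = reach-early α x (trans (cong pos (sym (visited-suc-nothing α x l))) e)
  ... | inj₂ (k , l) = suc x , subst (suc x ≤_) e (reach-moved α x l) , e

  -- Since the walk only moves forward, position y can be reached only before time y + 1.
  reached? : ∀ α y → Dec (∃ λ x → x < suc y × reach α x ≡ y)
  reached? α y = anyUpTo? (λ x → reach α x ≟ y) (suc y)

  flips : Cantor → ℕ → Bool
  flips α y = does (reached? α y)

  flips-intro : ∀ α x {y} → reach α x ≡ y → flips α y ≡ true
  flips-intro α x {y} e with reach-early α x e
  ... | x' , x'≤y , e' = dec-true (reached? α y) (x' , s≤s x'≤y , e')

  flips-elim : ∀ α y → flips α y ≡ true → ∃ λ x → reach α x ≡ y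
  flips-elim α y e = let x , _ , r = toWitness {a? = reached? α y} (Equivalence.from T-≡ (trans (isYes≗does (reached? α y)) e))
                     in x , r

  flips-false : ∀ α y → (∀ x → reach α x ≢ y) → flips α y ≡ false
  flips-false α y unreached = dec-false (reached? α y) λ (x , _ , r) → unreached x r

  flips-local : ∀ α β y → (∀ x → x ≤ y → reach α x ≡ reach β x) → flips α y ≡ flips β y
  flips-local α β y same = does-⇔ (mk⇔
    (λ (x , x<1+y , r) → x , x<1+y , trans (sym (same x (s≤s⁻¹ x<1+y))) r)
    (λ (x , x<1+y , r) → x , x<1+y , trans (same x (s≤s⁻¹ x<1+y)) r))
    (reached? α y) (reached? β y)

  branch : Cantor → Cantor
  branch α y = α₀ y xor flips α y

  Δ-branch : ∀ α y → (α₀ Δ branch α) y ≡ flips α y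
  Δ-branch α y = trans (sym (xor-assoc (α₀ y) (α₀ y) (flips α y))) (cong (_xor flips α y) (xor-same (α₀ y)))

  branch-at-reach : ∀ α x → branch α (reach α x) ≡ true
  branch-at-reach α x = cong₂ _xor_ (α₀-pos (visited α x)) (flips-intro α x refl)

  branch-unflipped : ∀ α y → flips α y ≡ false → branch α y ≡ α₀ y
  branch-unflipped α y e = trans (cong (α₀ y xor_) e) (xor-identityʳ (α₀ y))

  no-flip-between : ∀ α x {y} → reach α x < y → y < reach α (suc x) → flips α y ≡ false
  no-flip-between α x {y} lo hi = flips-false α y λ x' r →
    [ (λ x'≤x → <⇒≱ lo (subst (_≤ reach α x) r (reach-mono α x'≤x)))
    , (λ x<x' → <⇒≱ hi (subst (reach α (suc x) ≤_) r (reach-mono α x<x'))) ]′ (≤-<-connex x' x)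

  no-flip-above-last : ∀ α {z N y} → (∀ z' → z < z' → z' ≤ N → N ≤ reach α z') →
    reach α z < y → y < N → flips α y ≡ false
  no-flip-above-last α {z} {N} {y} above lo hi = flips-false α y λ x r → let x' , x'≤y , r' = reach-early α x r in
    [ (λ x'≤z → <⇒≱ lo (subst (_≤ reach α z) r' (reach-mono α x'≤z)))
    , (λ z<x' → <⇒≱ hi (subst (N ≤_) r' (above x' z<x' (≤-trans x'≤y (<⇒≤ hi))))) ]′ (≤-<-connex x' z)

  -- Below q the branch follows t q, at q it is flipped, and above q it agrees with α₀ until
  -- the next position reached, just as s (pos (suc n)) = s q 0 R does.
  t-◁-branch-child : ∀ α x {k} → label α (suc x) ≡ just k → t (reach α x) ◁ branch α → t (reach α (suc x)) ◁ branch α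
  t-◁-branch-child α x {k} e t◁ = subst (λ i → t (pos i) ◁ branch α) (sym (visited-suc-just α x e))
    (subst (_◁ branch α) (sym (t-pos-suc n))
      (◁-splice {s q} {t q} {drop (suc q) (At.grown n) ++ At.bridge n} (trans (len-s q) (sym (len-t q)))
        (subst (_◁ α₀) (s-pos-suc-split n) (s-◁-α₀ (suc n)))
        (subst (λ i → t i ◁ branch α) (sym q≡) t◁)
        (trans (cong (branch α) (trans (len-t q) q≡)) (branch-at-reach α x))
        agree))
    where
    n = ⟨ visited α x , ⟨ k , x ⟩ ⟩
    q = parentPos n
    q≡ : q ≡ reach α x
    q≡ = trans (parentPos≡ n) (cong pos (φ₀-pair (visited α x) _))
    reach≡ : reach α (suc x) ≡ pos (suc n)
    reach≡ = cong pos (visited-suc-just α x e)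
    agree : ∀ i → length (t q) < i → i < length (t q ++ true ∷ drop (suc q) (At.grown n) ++ At.bridge n) → branch α i ≡ α₀ i
    agree i lo hi = branch-unflipped α i (no-flip-between α x
      (subst (_< i) (trans (len-t q) q≡) lo)
      (subst (i <_) (trans (cong length (sym (t-pos-suc n))) (trans (len-t _) (sym reach≡))) hi))

  t-◁-branch : ∀ α x → t (reach α x) ◁ branch α
  t-◁-branch α zero y y<0 = contradiction (subst (y <_) (len-t 0) y<0) n≮0
  t-◁-branch α (suc x) with label-cases α (suc x)
  ... | inj₁ e       = subst (λ i → t (pos i) ◁ branch α) (sym (visited-suc-nothing α x e)) (t-◁-branch α x)
  ... | inj₂ (k , e) = t-◁-branch-child α x e (t-◁-branch α x)

  α₀-splice : ∀ α z {N} → reach α z < N →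
    prefix α₀ N ≡ s (reach α z) ++ false ∷ prefix (λ j → α₀ (suc (reach α z) + j)) (N ∸ suc (reach α z))
  α₀-splice α z q<N = prefix-splice {s (reach α z)} α₀ α₀ (len-s (reach α z)) q<N
    (s-◁-α₀ (visited α z)) (α₀-pos (visited α z)) (λ _ _ _ → refl)

  branch-splice : ∀ α z {N} → reach α z < N → (∀ z' → z < z' → z' ≤ N → N ≤ reach α z') →
    prefix (branch α) N ≡ t (reach α z) ++ true ∷ prefix (λ j → α₀ (suc (reach α z) + j)) (N ∸ suc (reach α z))
  branch-splice α z q<N above = prefix-splice {t (reach α z)} (branch α) α₀ (len-t (reach α z)) q<N
    (t-◁-branch α z) (branch-at-reach α z) λ i lo hi → branch-unflipped α i (no-flip-above-last α above lo hi)

  -- The prefixes of length N split at the last position below N reached by the walk.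
  -- A with-clause here would make Agda normalise the goal and so evaluate the construction.
  branch-inBody : ∀ α → InBody s t α₀ (branch α)
  branch-inBody α zero    = inj₁ (refl , refl)
  branch-inBody α (suc n) = inj₂ (reach α z , prefix (λ j → α₀ (suc (reach α z) + j)) (suc n ∸ suc (reach α z)) ,
    α₀-splice α z q<N , branch-splice α z q<N (proj₂ (proj₂ (proj₂ last))))
    where
    last = last-below (reach α) z<s (suc n)
    z = proj₁ last
    q<N = proj₁ (proj₂ (proj₂ last))

  branch-continuous : Continuous branch
  branch-continuous α n = n , λ β agree i i<n → cong (α₀ i xor_) (flips-local α β i λ x x≤i →
    cong pos (visited-local α β x λ j j<x → agree j (<-≤-trans j<x (≤-trans x≤i (<⇒≤ i<n)))))

  reach-after-silence : ∀ α d → label α (suc d) ≡ nothing → ∀ x → reach α x ≡ 0 ⊎ pos (suc d) ≤ reach α x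
  reach-after-silence α d silent x with label-cases α x
  ... | inj₁ e = inj₁ (cong pos (visited-nothing α x e))
  reach-after-silence α d silent (suc x) | inj₂ (k , e) =
    inj₂ (subst (pos (suc d) ≤_) (cong pos (sym (visited-suc-just α x e))) (pos-mono-≤ (s≤s d≤child)))
    where
    d≤child : d ≤ ⟨ visited α x , ⟨ k , x ⟩ ⟩
    d≤child = ≤-trans (label-after-silence α d x silent e) (≤-child (visited α x) k x)

  -- While α is still silent, the branch is α₀ with only its first bit flipped.
  root-◁-branch : ∀ α d → label α (suc d) ≡ nothing →
    flipHead (At.forced d) ++ force d (flipHead (At.forced d)) ◁ branch α
  root-◁-branch α d silent = flipHead-◁ {At.forced d} forced-nonempty root◁α₀ head agree
    where
    forced-nonempty : 0 < length (At.forced d)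
    forced-nonempty = ≤-trans (subst (0 <_) (sym (node-length d)) z<s) (≼-length (≼-++ (node d) _))
    root◁α₀ : At.forcedRoot d ◁ α₀
    root◁α₀ = ◁-≼ (≼-trans (≼-++ (At.forcedRoot d) _) (grown≼node-suc d)) (node-◁-α₀ (suc d))
    head : branch α 0 ≡ not (α₀ 0)
    head = trans (branch-at-reach α 0) (cong not (sym (α₀-pos 0)))
    agree : ∀ i → 0 < i → i < length (At.forcedRoot d) → branch α i ≡ α₀ i
    agree i 0<i i<root = branch-unflipped α i (flips-false α i λ x r →
      [ (λ r0 → <⇒≢ 0<i (trans (sym r0) r))
      , (λ far → <⇒≱ (≤-trans i<root (≤-trans (≼-length (≼-++ (At.forcedRoot d) _)) (grown-length d)))
                      (subst (pos (suc d) ≤_) r far)) ]′ (reach-after-silence α d silent x))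

  t-pos-suc-mirror : ∀ n → t (pos (suc n)) ≡ (At.mirror n ++ force n (At.mirror n)) ++ At.bridge n
  t-pos-suc-mirror n = begin
    t (pos (suc n))                                  ≡⟨ t-pos-suc n ⟩
    t q ++ true ∷ drop (suc q) (root ++ F) ++ bridge ≡⟨ cong (λ u → t q ++ true ∷ u ++ bridge) (drop-++-≤ (suc q) root F q<root) ⟩
    t q ++ true ∷ (drop (suc q) root ++ F) ++ bridge ≡⟨ cong (λ u → t q ++ true ∷ u) (++-assoc (drop (suc q) root) F bridge) ⟩
    t q ++ true ∷ drop (suc q) root ++ F ++ bridge   ≡⟨ ++-assoc (t q) (true ∷ drop (suc q) root) (F ++ bridge) ⟨
    mirror ++ F ++ bridge                            ≡⟨ ++-assoc mirror F bridge ⟨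
    (mirror ++ F) ++ bridge                          ∎
    where
    q = parentPos n
    root = At.forcedRoot n
    mirror = At.mirror n
    F = force n mirror
    bridge = At.bridge n
    q<root : suc q ≤ length root
    q<root = subst (_≤ length root) (trans (node-length (φ₀ n)) (cong suc (sym (parentPos≡ n))))
      (≤-trans (≼-length (chain-≼ (≤⇒≤′ (φ₀≤ n)))) (≼-length (≼-trans (≼-++ (node n) _) (≼-++ (At.forced n) _))))

  branch-meets : ∀ α d → U d (branch α)
  branch-meets α d with label-cases α (suc d)
  ... | inj₁ e       = force-sound ≤′-refl (flipHead (At.forced d)) (branch α) (root-◁-branch α d e)
  ... | inj₂ (k , e) = force-sound (≤⇒≤′ d≤n) (At.mirror n) (branch α)
    (◁-≼ (At.bridge n , t-pos-suc-mirror n) t◁)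
    where
    n = ⟨ visited α d , ⟨ k , d ⟩ ⟩
    d≤n : d ≤ n
    d≤n = ≤-child (visited α d) k d
    t◁ : t (pos (suc n)) ◁ branch α
    t◁ = subst (λ i → t (pos i) ◁ branch α) (visited-suc-just α d e) (t-◁-branch α (suc d))

  branch∈G : ∀ α → G (branch α)
  branch∈G α = U⇒G (branch-meets α)

  φ₀-reach-pred : ∀ α x {k} → label α (suc x) ≡ just k → φ₀ (reach α (suc x) ∸ 1) ≡ k
  φ₀-reach-pred α x {k} e = trans (cong (λ i → φ₀ (pos i ∸ 1)) (visited-suc-just α x e))
    (trans (φ₀-pos-suc ⟨ visited α x , ⟨ k , x ⟩ ⟩) (κ-pair (visited α x) k x))

  flip-from-one : ∀ α u m → α (p (u ∷ʳ m)) ≡ true → ∃ λ m' → (α₀ Δ branch α) (p (u ∷ʳ m') + 1) ≡ true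
  flip-from-one α u m one = m' , (begin
    (α₀ Δ branch α) (p (u ∷ʳ m') + 1) ≡⟨ Δ-branch α (p (u ∷ʳ m') + 1) ⟩
    flips α (p (u ∷ʳ m') + 1)         ≡⟨ cong (flips α) (trans (cong (_+ 1) (proj₂ fibre)) (m∸n+n≡m 1≤reach)) ⟩
    flips α (reach α (suc x))         ≡⟨ flips-intro α (suc x) refl ⟩
    true                              ∎)
    where
    x = p (u ∷ʳ m)
    moving : label α (suc x) ≡ just (φ₀ x)
    moving = label-true α x one
    fibre : ∃ λ m' → p (u ∷ʳ m') ≡ reach α (suc x) ∸ 1
    fibre = p-∷ʳ-fibre u m (reach α (suc x) ∸ 1) (φ₀-reach-pred α x moving)
    m' = proj₁ fibre
    1≤reach : 1 ≤ reach α (suc x)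
    1≤reach = ≤-trans (s≤s z≤n) (reach-moved α x moving)

  one-behind-flip : ∀ α u m x → reach α x ≡ suc (p (u ∷ʳ m)) → ∃ λ m' → α (p (u ∷ʳ m')) ≡ true
  one-behind-flip α u m x r with label-cases α x
  ... | inj₁ e = contradiction (trans (sym r) (cong pos (visited-nothing α x e))) 1+n≢0
  one-behind-flip α u m (suc x) r | inj₂ (k , e) with label-just α (suc x) e
  ... | x' , _ , αx' , φ₀x'≡k =
    let m' , pm' = p-∷ʳ-fibre u m x' (trans φ₀x'≡k (trans (sym (φ₀-reach-pred α x e)) (cong (λ y → φ₀ (y ∸ 1)) r)))
    in m' , trans (cong α pm') αx'

  one-from-flip : ∀ α u m → (α₀ Δ branch α) (p (u ∷ʳ m) + 1) ≡ true → ∃ λ m' → α (p (u ∷ʳ m')) ≡ true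
  one-from-flip α u m flip =
    let x , r = flips-elim α (p (u ∷ʳ m) + 1) (trans (sym (Δ-branch α (p (u ∷ʳ m) + 1))) flip)
    in one-behind-flip α u m x (trans r (+-comm (p (u ∷ʳ m)) 1))

lemma16 : (s t : ℕ → List Bool) → IsTest s t →
    (G : Cantor → Set) → IsGδ G → Dense G →
    Σ Cantor λ α₀ → G α₀ × Σ (Cantor → Cantor) λ f →
      Continuous f × (∀ α → G (f α)) ×
      (∀ α → InBody s t α₀ (f α) ×
        (∀ (u : List ℕ) (m : ℕ) →
          (α (p (u ∷ʳ m)) ≡ true → ∃ λ m' → (α₀ Δ f α) (p (u ∷ʳ m') + 1) ≡ true) ×
          ((α₀ Δ f α) (p (u ∷ʳ m) + 1) ≡ true → ∃ λ m' → α (p (u ∷ʳ m')) ≡ true)))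
lemma16 s t test G gδ dense =
  α₀ , α₀∈G , branch , branch-continuous , branch∈G ,
  λ α → branch-inBody α , λ u m → flip-from-one α u m , one-from-flip α u m
  where open Construction test gδ dense
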